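{- There are infinitely many pairs $(b,y)$ of integers with $b\ge 2$, $y\ge 1$, for which there exists a word $w$ over $\{0,1,\dots,b-1\}$ with $|w|=2$ such that $(y^3)_b = w\uparrow 2$; equivalently, infinitely many positive integer solutions $(b,y,c)$ of $y^3=c(b^2+1)$ with $b\le c<b^2$.
   Context: $(m)_b$ denotes the canonical base-$b$ representation of the integer $m$ (no leading zeros); $|w|$ is the length of the word $w$ and $w\uparrow n$ is the concatenation of $n$ copies of $w$. -}

module Defs where

open import Data.Nat using (ℕ; zero; suc; _+_; _*_; _/_; _%_; _≤_; _<_; NonZero)
open import Data.Nat.Properties using (≤-refl)
open import Data.List using (List; []; _∷_; _++_; concat; replicate; reverse)
open import Data.Fin using (Fin; toℕ)
open import Data.Product using (_×_)

-- digits, least significant first, computed with fuel (fuel ≥ m suffices since b ≥ 2)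
digitsLE : (fuel b m : ℕ) → .{{NonZero b}} → List ℕ
digitsLE zero b m = []
digitsLE (suc f) b zero = []
digitsLE (suc f) b (suc m) = (suc m % b) ∷ digitsLE f b (suc m / b)

-- canonical base-b representation (m)_b, most significant digit first, no leading zeros
-- ((0)_b is the empty word under this convention; irrelevant here since y ≥ 1)
-- (for b = 0 a dummy value; only used with b ≥ 2)
rep : (b m : ℕ) → List ℕ
rep zero m = []
rep (suc c) m = reverse (digitsLE m (suc c) m)

_↑_ : {A : Set} → List A → ℕ → List A
w ↑ n = concat (replicate n w)

word : (b : ℕ) → List (Fin b) → List ℕ
word b [] = []
word b (d ∷ w) = toℕ d ∷ word b w

{-# OPTIONS --safe #-}
-- For r ≥ 1 put b = 2r(16r² + 3) and y = (16r² + 1)(4r² + 1). Then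
-- b² + 1 = (16r² + 1)²(4r² + 1), so y³ = c(b² + 1) with c = (16r² + 1)(4r² + 1)²,
-- and c = (8r³ + 3r) b + (6r² + 1) has the two base-b digits 8r³ + 3r, 6r² + 1.
-- Multiplying a two-digit number by b² + 1 writes its digits twice, so (y³)_b is
-- a two-letter word repeated twice, and b grows without bound with r.
module Submission where

open import Defs
open import Data.Nat using (ℕ; zero; suc; _+_; _*_; _%_; _/_; _≤_; _<_; _⊔_; z≤n; s≤s; NonZero; >-nonZero⁻¹)
open import Data.Nat.Properties
open import Data.Nat.DivMod using ([m+kn]%n≡m%n; m<n⇒m%n≡m; +-distrib-/-∣ʳ; m<n⇒m/n≡0; m*n/n≡m)
open import Data.Nat.Divisibility using (divides-refl)
open import Data.Nat.Tactic.RingSolver using (solve-∀)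
open import Data.List using (List; []; _∷_; _++_; [_]; length; foldr; reverse)
open import Data.List.Relation.Unary.All using (All; []; _∷_)
open import Data.Fin using (Fin; fromℕ<)
open import Data.Fin.Properties using (toℕ-fromℕ<)
open import Data.Product using (_×_; ∃-syntax; _,_)
open import Relation.Binary.PropositionalEquality using (_≡_; refl; sym; trans; cong; cong₂; subst; module ≡-Reasoning)

fromDigitsLE : ℕ → List ℕ → ℕ
fromDigitsLE b = foldr (λ d v → d + v * b) 0

module _ {b : ℕ} .{{_ : NonZero b}} where

  digitsLE-zero : ∀ f → digitsLE f b 0 ≡ []
  digitsLE-zero zero    = refl
  digitsLE-zero (suc f) = refl

  digitsLE-suc : ∀ f {m} → 1 ≤ m → digitsLE (suc f) b m ≡ m % b ∷ digitsLE f b (m / b)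
  digitsLE-suc f {suc m} _ = refl

  [d+qb]%b≡d : ∀ {d} q → d < b → (d + q * b) % b ≡ d
  [d+qb]%b≡d {d} q d<b = trans ([m+kn]%n≡m%n d q b) (m<n⇒m%n≡m d<b)

  [d+qb]/b≡q : ∀ {d} q → d < b → (d + q * b) / b ≡ q
  [d+qb]/b≡q {d} q d<b = begin
    (d + q * b) / b      ≡⟨ +-distrib-/-∣ʳ d (divides-refl q) ⟩
    d / b + q * b / b    ≡⟨ cong₂ _+_ (m<n⇒m/n≡0 d<b) (m*n/n≡m q b) ⟩
    q                    ∎
    where open ≡-Reasoning

  digitsLE-digit∷ : ∀ f {d} q → d < b → 1 ≤ d + q * b →
                    digitsLE (suc f) b (d + q * b) ≡ d ∷ digitsLE f b q
  digitsLE-digit∷ f {d} q d<b pos = begin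
    digitsLE (suc f) b (d + q * b)                          ≡⟨ digitsLE-suc f pos ⟩
    (d + q * b) % b ∷ digitsLE f b ((d + q * b) / b)        ≡⟨ cong₂ (λ x v → x ∷ digitsLE f b v) ([d+qb]%b≡d q d<b) ([d+qb]/b≡q q d<b) ⟩
    d ∷ digitsLE f b q                                       ∎
    where open ≡-Reasoning

  fromDigitsLE-snoc-positive : ∀ ds {d} → 1 ≤ d → 1 ≤ fromDigitsLE b (ds ++ [ d ])
  fromDigitsLE-snoc-positive []       {d} 1≤d = ≤-trans 1≤d (m≤m+n d 0)
  fromDigitsLE-snoc-positive (e ∷ ds)     1≤d =
    ≤-trans (*-mono-≤ (fromDigitsLE-snoc-positive ds 1≤d) (>-nonZero⁻¹ b)) (m≤n+m _ e)

  length≤fromDigitsLE-snoc : 2 ≤ b → ∀ ds {d} → 1 ≤ d → length (ds ++ [ d ]) ≤ fromDigitsLE b (ds ++ [ d ])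
  length≤fromDigitsLE-snoc 2≤b []       {d} 1≤d = ≤-trans 1≤d (m≤m+n d 0)
  length≤fromDigitsLE-snoc 2≤b (e ∷ ds)     1≤d = begin
    suc (length (ds ++ _))   ≤⟨ s≤s (length≤fromDigitsLE-snoc 2≤b ds 1≤d) ⟩
    1 + v                    ≤⟨ +-monoˡ-≤ v (fromDigitsLE-snoc-positive ds 1≤d) ⟩
    v + v                    ≡⟨ cong (v +_) (sym (+-identityʳ v)) ⟩
    2 * v                    ≤⟨ *-monoˡ-≤ v 2≤b ⟩
    b * v                    ≡⟨ *-comm b v ⟩
    v * b                    ≤⟨ m≤n+m (v * b) e ⟩
    e + v * b                ∎
    where open ≤-Reasoning
          v = fromDigitsLE b (ds ++ _)

  -- The shape ds ++ [ d ] with 1 ≤ d expresses that the top digit is nonzero.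
  digitsLE-fromDigitsLE-snoc : ∀ f ds {d} → All (_< b) ds → d < b → 1 ≤ d → length (ds ++ [ d ]) ≤ f →
                               digitsLE f b (fromDigitsLE b (ds ++ [ d ])) ≡ ds ++ [ d ]
  digitsLE-fromDigitsLE-snoc (suc f) [] {d} [] d<b 1≤d _ =
    trans (digitsLE-digit∷ f 0 d<b (≤-trans 1≤d (m≤m+n d 0))) (cong (d ∷_) (digitsLE-zero f))
  digitsLE-fromDigitsLE-snoc (suc f) (e ∷ ds) (e<b ∷ ds<b) d<b 1≤d (s≤s len≤f) =
    trans (digitsLE-digit∷ f _ e<b (fromDigitsLE-snoc-positive (e ∷ ds) 1≤d))
          (cong (e ∷_) (digitsLE-fromDigitsLE-snoc f ds ds<b d<b 1≤d len≤f))

rep-fromDigitsLE-snoc : ∀ {b} ds {d} → 2 ≤ b → All (_< b) ds → d < b → 1 ≤ d →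
                        rep b (fromDigitsLE b (ds ++ [ d ])) ≡ reverse (ds ++ [ d ])
rep-fromDigitsLE-snoc ds 2≤b@(s≤s (s≤s _)) ds<b d<b 1≤d =
  cong reverse (digitsLE-fromDigitsLE-snoc _ ds ds<b d<b 1≤d (length≤fromDigitsLE-snoc 2≤b ds 1≤d))

doubled-two-digit : ∀ b x₁ x₀ → (x₁ * b + x₀) * (b * b + 1) ≡ x₀ + (x₁ + (x₀ + (x₁ + 0) * b) * b) * b
doubled-two-digit = solve-∀

rep-doubled-two-digit : ∀ {b x₁ x₀} (x₁<b : x₁ < b) (x₀<b : x₀ < b) → 1 ≤ x₁ →
                        rep b ((x₁ * b + x₀) * (b * b + 1)) ≡ word b (fromℕ< x₁<b ∷ fromℕ< x₀<b ∷ []) ↑ 2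
rep-doubled-two-digit {b} {x₁} {x₀} x₁<b x₀<b 1≤x₁ = begin
  rep b ((x₁ * b + x₀) * (b * b + 1))                        ≡⟨ cong (rep b) (doubled-two-digit b x₁ x₀) ⟩
  rep b (fromDigitsLE b ((x₀ ∷ x₁ ∷ x₀ ∷ []) ++ [ x₁ ]))     ≡⟨ rep-fromDigitsLE-snoc (x₀ ∷ x₁ ∷ x₀ ∷ []) 2≤b (x₀<b ∷ x₁<b ∷ x₀<b ∷ []) x₁<b 1≤x₁ ⟩
  x₁ ∷ x₀ ∷ x₁ ∷ x₀ ∷ []                                     ≡⟨ cong₂ (λ u v → u ∷ v ∷ u ∷ v ∷ []) (sym (toℕ-fromℕ< x₁<b)) (sym (toℕ-fromℕ< x₀<b)) ⟩
  word b (fromℕ< x₁<b ∷ fromℕ< x₀<b ∷ []) ↑ 2                ∎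
  where open ≡-Reasoning
        2≤b : 2 ≤ b
        2≤b = ≤-trans (s≤s 1≤x₁) x₁<b

familyBase familyRoot familyHigh familyLow : ℕ → ℕ
familyBase r = 2 * r * (16 * r * r + 3)
familyRoot r = (16 * r * r + 1) * (4 * r * r + 1)
familyHigh r = 8 * r * r * r + 3 * r
familyLow  r = 6 * r * r + 1

familyRoot-cube : ∀ r → familyRoot r * familyRoot r * familyRoot r
                      ≡ (familyHigh r * familyBase r + familyLow r) * (familyBase r * familyBase r + 1)
-- solve-∀ does not unfold the family definitions, so it is applied to the unfolded polynomials.
familyRoot-cube = cube
  where
  cube : ∀ r → (16 * r * r + 1) * (4 * r * r + 1) * ((16 * r * r + 1) * (4 * r * r + 1)) * ((16 * r * r + 1) * (4 * r * r + 1))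
             ≡ ((8 * r * r * r + 3 * r) * (2 * r * (16 * r * r + 3)) + (6 * r * r + 1))
               * (2 * r * (16 * r * r + 3) * (2 * r * (16 * r * r + 3)) + 1)
  cube = solve-∀

familyRoot-positive : ∀ r → 1 ≤ familyRoot r
familyRoot-positive r = *-mono-≤ (m≤n+m 1 (16 * r * r)) (m≤n+m 1 (4 * r * r))

familyHigh-positive : ∀ k → 1 ≤ familyHigh (suc k)
familyHigh-positive k = ≤-trans (s≤s z≤n) (m≤n+m (3 * suc k) (8 * suc k * suc k * suc k))

familyHigh<familyBase : ∀ k → familyHigh (suc k) < familyBase (suc k)
familyHigh<familyBase k = subst (familyHigh (suc k) <_) (sym (split k)) (m<m+n _ (s≤s z≤n))
  where
  split : ∀ k → 2 * suc k * (16 * suc k * suc k + 3)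
              ≡ (8 * suc k * suc k * suc k + 3 * suc k) + suc (24 * suc k * suc k * suc k + 3 * k + 2)
  split = solve-∀

familyLow<familyBase : ∀ k → familyLow (suc k) < familyBase (suc k)
familyLow<familyBase k = subst (familyLow (suc k) <_) (sym (split k)) (m<m+n _ (s≤s z≤n))
  where
  split : ∀ k → 2 * suc k * (16 * suc k * suc k + 3)
              ≡ (6 * suc k * suc k + 1) + suc (32 * k * k * k + 90 * k * k + 90 * k + 30)
  split = solve-∀

index≤familyBase : ∀ k → k ≤ familyBase (suc k)
index≤familyBase k = subst (k ≤_) (sym (split k)) (m≤m+n k _)
  where
  split : ∀ k → 2 * suc k * (16 * suc k * suc k + 3) ≡ k + (32 * suc k * suc k * suc k + 5 * k + 6)
  split = solve-∀

mainTheorem10 : ∀ (N : ℕ) → ∃[ b ] ∃[ y ] (2 ≤ b × 1 ≤ y × N ≤ b ⊔ y ×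
                  ∃[ w ] (length {A = Fin b} w ≡ 2 × rep b (y * y * y) ≡ word b w ↑ 2))
mainTheorem10 N =
  familyBase r , familyRoot r , ≤-trans (s≤s (familyHigh-positive N)) high<b , familyRoot-positive r ,
  ≤-trans (index≤familyBase N) (m≤m⊔n (familyBase r) (familyRoot r)) ,
  (fromℕ< high<b ∷ fromℕ< low<b ∷ []) , refl ,
  trans (cong (rep (familyBase r)) (familyRoot-cube r)) (rep-doubled-two-digit high<b low<b (familyHigh-positive N))
  where
  r = suc N
  high<b = familyHigh<familyBase N
  low<b  = familyLow<familyBase N
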